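{- Let $m,n\geq 1$ be integers and let $G_{m\times n}=P_m\square P_n$ be the grid graph with vertex set $[m]\times[n]$, where $(i,j)$ and $(i',j')$ are adjacent if and only if $|i-i'|+|j-j'|=1$. Let $d=\gcd(m+1,n+1)$ and let $v=(a,b)$ be a vertex of $G_{m\times n}$. Then, in the Undirected Edge Geography game, $(G_{m\times n},v)$ is a P-position if and only if $d\nmid a$ and $d\nmid b$.
   Context: Undirected Edge Geography (UEG) is a two-player game on a rooted graph. A position is a pair $(H,v)$ with $H$ a graph and $v$ a vertex (the root). A move consists of choosing an edge of $H$ incident to $v$, deleting it from $H$, and making its other endpoint the new root. Players alternate moves; the first player unable to move loses. A position is an N-position if the player to move has a winning strategy, and a P-position otherwise (the player who just moved wins). -}

module Defs where

open import Data.Nat using (ℕ; suc; ∣_-_∣; _+_)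
open import Data.Fin using (Fin; toℕ)
open import Data.Product using (_×_; _,_)
open import Data.Sum using (_⊎_)
open import Relation.Nullary using (¬_)
open import Relation.Binary.PropositionalEquality using (_≡_)

-- A (simple, undirected) graph on vertex type V is given by its edge
-- relation: H x y holds iff {x,y} is an edge of H (symmetric).
Graph : Set → Set₁
Graph V = V → V → Set

deleteEdge : {V : Set} → Graph V → V → V → Graph V
deleteEdge H u w x y = H x y × ¬ ((x ≡ u × y ≡ w) ⊎ (x ≡ w × y ≡ u))

data IsN {V : Set} : Graph V → V → Set₁
data IsP {V : Set} : Graph V → V → Set₁

data IsN {V} where
  win : ∀ {H v} (w : V) → H v w → IsP (deleteEdge H v w) w → IsN H v

data IsP {V} where
  lose : ∀ {H v} → (∀ (w : V) → H v w → IsN (deleteEdge H v w) w) → IsP H v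

-- Vertex (i , j) : Fin m × Fin n
-- corresponds to the paper's vertex (toℕ i + 1 , toℕ j + 1) ∈ [m] × [n].
-- Adjacency: |i - i'| + |j - j'| = 1 (invariant under the index shift).
Grid : (m n : ℕ) → Graph (Fin m × Fin n)
Grid m n (i , j) (i' , j') = ∣ toℕ i - toℕ i' ∣ + ∣ toℕ j - toℕ j' ∣ ≡ 1

-- A set A of vertices certifies a graph H if no edge of H joins two vertices of A and every vertex
-- outside A has an even number of neighbours in A. The player to move at a vertex x ∈ A then loses:
-- after the move along xu, the vertex u ∉ A has an odd number of A-neighbours left, so there is a
-- reply along some uy with y ∈ A, and A certifies H − xu − uy again. Dually, if v ∉ A is the only
-- vertex outside A with an odd number of A-neighbours, moving from v into A wins.
--
-- On the grid, certificates come from 0/1 functions F on the box [0, m+1] × [0, n+1] vanishing on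
-- its boundary whose mod-2 Laplacian on the grid points is 0 (for P) or the indicator of v (for N):
-- the support of F within one colour class of the chessboard colouring is independent, and every
-- point of the other class sees the Laplacian of F. Let d = gcd (m+1) (n+1). If d ∤ a and d ∤ b,
-- fold ℕ onto [0, d] by reflections at the multiples of d; the closed billiard path of the square
-- [0, d]² through the folded point of (a, b) is harmonic inside the square and vanishes on its walls,
-- so pulled back along the fold it is harmonic on the box, vanishes on its boundary (d divides m+1
-- and n+1), and contains (a, b). If d ∣ b, Bézout gives T with (m+1) ∣ T and (n+1) ∣ T + b; the a
-- diagonal rays of length T starting at (1, a+b), …, (a, b+1), folded into the box by reflection at
-- its walls, have Laplacian the indicator of (a, b) plus terms at the ends of the rays, which all lie
-- on the boundary. The case d ∣ a is the transpose.

module Submission where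

open import Defs
open import Algebra.Bundles using (CommutativeRing)
open import Data.Bool using (Bool; true; false; not; _∧_; _xor_; T)
open import Data.Bool.Properties
  using (xor-same; xor-comm; xor-assoc; xor-identityʳ; not-distribˡ-xor; not-distribʳ-xor; ∧-comm;
         ∧-zeroʳ; ∧-distribˡ-xor; ∧-distribʳ-xor; xor-∧-commutativeRing)
open import Algebra.Properties.CommutativeSemigroup
  (CommutativeRing.+-commutativeSemigroup xor-∧-commutativeRing)
  using () renaming (interchange to xor-interchange)
open import Data.Empty using (⊥-elim)
open import Data.Fin using (Fin; zero; suc; toℕ; fromℕ<; inject₁)
import Data.Fin as Fin
open import Data.Fin.Properties using (toℕ-injective; toℕ<n; toℕ-fromℕ<; toℕ-inject₁)
open import Data.List
  using (List; []; _∷_; foldr; map; filter; length; mapMaybe; cartesianProduct; allFin)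
open import Data.List.Membership.Propositional using (_∈_)
open import Data.List.Membership.Propositional.Properties using (∈-cartesianProduct⁺; ∈-allFin)
open import Data.List.Relation.Binary.Sublist.Heterogeneous.Properties
  using (length-mono-≤; ⊆-filter-Sublist)
open import Data.List.Relation.Binary.Sublist.Propositional using (⊆-refl)
open import Data.List.Relation.Unary.All as All using (All; []; _∷_)
open import Data.List.Relation.Unary.Any using (here; there)
open import Data.List.Relation.Unary.Unique.Propositional using (Unique; []; _∷_)
open import Data.Maybe using (Maybe; just; nothing; maybe′)
import Data.Maybe as Maybe
open import Data.Nat
  using (ℕ; zero; suc; pred; _+_; _*_; _∸_; _⊔_; ∣_-_∣; _<_; _≤_; _<ᵇ_; _≡ᵇ_; z≤n; s≤s; z<s;
         _<?_; parity)
open import Data.Nat.Properties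
  using (_≟_; +-assoc; +-comm; +-suc; +-identityʳ; +-cancelˡ-≡; *-assoc; +-mono-<; +-mono-≤-<;
         +-monoʳ-≤; 1+n≢n; suc-injective; n≢0⇒n>0; <-irrefl; <-trans; <-≤-trans; ≤-<-trans; ≤-trans;
         ≤-refl; ≤-antisym; ≤-pred; <⇒≢; >⇒≢; <⇒≤; <⇒≱; ≮⇒≥; <ᵇ⇒<; ≡ᵇ⇒≡; m<n+m; m≤m+n; m≤n⇒m≤1+n;
         n<1+n; n≤1+n; pred[n]≤n; m+[n∸m]≡n; m+n∸m≡n; ⊔-lub; m⊔n≤m+n; ∣-∣-comm; ∣m-n∣≤m⊔n;
         ∣m-n∣≡0⇒m≡n; m≡n⇒∣m-n∣≡0; m≤n⇒∣n-m∣≡n∸m)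
open import Data.Nat.Divisibility using (_∣_; divides; ∣-refl; ∣m+n∣m⇒∣n; n∣m*n; ∣⇒≤)
open import Data.Nat.GCD
  using (gcd; gcd[m,n]∣m; gcd[m,n]∣n; gcd[m,n]≢0; gcd-comm; gcd-GCD; module Bézout)
open import Data.Nat.Tactic.RingSolver using (solve-∀)
open import Data.Parity using (Parity; _⁻¹)
open import Data.Parity.Properties
  using (suc-homo-⁻¹; p≢p⁻¹; ⁻¹-selfInverse) renaming (_≟_ to _≟ₚ_)
open import Data.Product using (_×_; _,_; proj₁; proj₂; ∃-syntax; Σ-syntax; uncurry)
import Data.Product as Prod
open import Data.Product.Properties using (≡-dec)
open import Data.Sign using (Sign)
import Data.Sign as Sign
open import Data.Sum using (_⊎_; inj₁; inj₂; [_,_])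
import Data.Sum as Sum
open import Data.Unit using (tt)
open import Function using (_∘_)
open import Function.Bundles using (_⇔_; mk⇔)
open import Relation.Binary.Definitions using (DecidableEquality)
open import Relation.Binary.PropositionalEquality
  using (_≡_; _≢_; refl; sym; trans; cong; cong₂; subst; module ≡-Reasoning)
open import Relation.Nullary using (¬_; Dec; yes; no; does)
open import Relation.Nullary.Decidable using (_×-dec_; _⊎-dec_; ¬?; dec-true; dec-false; does-⇔)
open import Relation.Unary using (Decidable)

xors : List Bool → Bool
xors = foldr _xor_ false

module _ {I : Set} where

  xors-cong : ∀ {xs : List I} {f g : I → Bool} → All (λ i → f i ≡ g i) xs →
              xors (map f xs) ≡ xors (map g xs)
  xors-cong []       = refl
  xors-cong (e ∷ es) = cong₂ _xor_ e (xors-cong es)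

  xors-flip : ∀ {xs : List I} {x} (f g : I → Bool) → Unique xs → x ∈ xs →
              g x ≡ not (f x) → (∀ i → i ≢ x → g i ≡ f i) →
              xors (map g xs) ≡ not (xors (map f xs))
  xors-flip {y ∷ ys} f g (y∉ys ∷ _) (here refl) gy others =
    trans (cong₂ _xor_ gy (xors-cong (All.map (λ y≢i → others _ (y≢i ∘ sym)) y∉ys)))
          (sym (not-distribˡ-xor (f y) _))
  xors-flip {y ∷ ys} f g (y∉ys ∷ unique) (there x∈ys) gx others =
    trans (cong₂ _xor_ (others y (All.lookup y∉ys x∈ys)) (xors-flip f g unique x∈ys gx others))
          (sym (not-distribʳ-xor (f y) _))

  xors-true : ∀ (f : I → Bool) xs → xors (map f xs) ≡ true → ∃[ i ] i ∈ xs × f i ≡ true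
  xors-true f (x ∷ xs) odd with f x in fx
  ... | true  = x , here refl , fx
  ... | false with xors-true f xs odd
  ...   | i , i∈xs , fi = i , there i∈xs , fi

  xors-∧ : ∀ (f : I → Bool) b xs → xors (map (λ i → f i ∧ b) xs) ≡ xors (map f xs) ∧ b
  xors-∧ f b []       = refl
  xors-∧ f b (x ∷ xs) = trans (cong (f x ∧ b xor_) (xors-∧ f b xs)) (sym (∧-distribʳ-xor b (f x) _))

  length-filter-< : ∀ {P Q : I → Set} (P? : Decidable P) (Q? : Decidable Q) {xs x} →
                    (∀ {i} → P i → Q i) → x ∈ xs → Q x → ¬ P x →
                    length (filter P? xs) < length (filter Q? xs)
  length-filter-< P? Q? {y ∷ ys} P⇒Q y∈ Qx ¬Px with P? y | Q? y | y∈
  ... | yes Py | _      | here refl = ⊥-elim (¬Px Py)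
  ... | no _   | no ¬Qy | here refl = ⊥-elim (¬Qy Qx)
  ... | no _   | yes _  | here refl =
    s≤s (length-mono-≤ (⊆-filter-Sublist P? Q? (λ { refl → P⇒Q }) (⊆-refl {x = ys})))
  ... | yes Py | no ¬Qy | _         = ⊥-elim (¬Qy (P⇒Q Py))
  ... | yes _  | yes _  | there x∈ = s≤s (length-filter-< P? Q? P⇒Q x∈ Qx ¬Px)
  ... | no _   | yes _  | there x∈ = m≤n⇒m≤1+n (length-filter-< P? Q? P⇒Q x∈ Qx ¬Px)
  ... | no _   | no _   | there x∈ = length-filter-< P? Q? P⇒Q x∈ Qx ¬Px

module _ {I J : Set} {f : I → Maybe J} where

  mapMaybe-unique : (∀ {x y z} → f x ≡ just z → f y ≡ just z → x ≡ y) →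
                    ∀ {xs} → Unique xs → Unique (mapMaybe f xs)
  mapMaybe-unique f-inj {[]}     []               = []
  mapMaybe-unique f-inj {x ∷ xs} (x∉xs ∷ unique) with f x in fx
  ... | nothing = mapMaybe-unique f-inj unique
  ... | just z  = fresh x∉xs ∷ mapMaybe-unique f-inj unique
    where
    fresh : ∀ {ys} → All (x ≢_) ys → All (z ≢_) (mapMaybe f ys)
    fresh {[]}     []           = []
    fresh {y ∷ ys} (x≢y ∷ x∉ys) with f y in fy
    ... | nothing = fresh x∉ys
    ... | just _  = (λ { refl → x≢y (f-inj fx fy) }) ∷ fresh x∉ys

  ∈-mapMaybe⁺ : ∀ {xs x y} → x ∈ xs → f x ≡ just y → y ∈ mapMaybe f xs
  ∈-mapMaybe⁺ {x' ∷ xs} (here refl) fx with f x'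
  ∈-mapMaybe⁺ (here refl) refl | just _ = here refl
  ∈-mapMaybe⁺ {x' ∷ xs} (there x∈) fx with f x'
  ... | nothing = ∈-mapMaybe⁺ x∈ fx
  ... | just _  = there (∈-mapMaybe⁺ x∈ fx)

  xors-mapMaybe : ∀ (g : J → Bool) xs →
                  xors (map g (mapMaybe f xs)) ≡ xors (map (maybe′ g false ∘ f) xs)
  xors-mapMaybe g []       = refl
  xors-mapMaybe g (x ∷ xs) with f x
  ... | nothing = xors-mapMaybe g xs
  ... | just y  = cong (g y xor_) (xors-mapMaybe g xs)

-- Undirected edge geography

module Geography {V : Set} (_≟_ : DecidableEquality V)
                 (vertices : List V) (∈-vertices : ∀ v → v ∈ vertices)
                 (H₀ : Graph V) (neighbours : V → List V)
                 (neighbours-unique : ∀ u → Unique (neighbours u))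
                 (neighbours-complete : ∀ {u w} → H₀ u w → w ∈ neighbours u)
                 (A : V → Bool)
                 (A-independent : ∀ {u w} → H₀ u w → A u ≡ true → A w ≡ false) where

  record Subgraph (H : Graph V) : Set where
    field
      decide    : ∀ u w → Dec (H u w)
      symmetric : ∀ {u w} → H u w → H w u
      ⊆H₀       : ∀ {u w} → H u w → H₀ u w
  open Subgraph

  delete : ∀ {H} → Subgraph H → ∀ v w → Subgraph (deleteEdge H v w)
  delete S v w = record
    { decide    = λ p q → decide S p q ×-dec ¬? ((p ≟ v ×-dec q ≟ w) ⊎-dec (p ≟ w ×-dec q ≟ v))
    ; symmetric = λ (h , ¬e) → symmetric S h , ¬e ∘ Sum.swap ∘ Sum.map Prod.swap Prod.swap
    ; ⊆H₀       = ⊆H₀ S ∘ proj₁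
    }

  edgeCount : ∀ {H} → Subgraph H → ℕ
  edgeCount S = length (filter (λ e → decide S (proj₁ e) (proj₂ e)) (cartesianProduct vertices vertices))

  edgeCount-delete : ∀ {H} (S : Subgraph H) {v w} → H v w → edgeCount (delete S v w) < edgeCount S
  edgeCount-delete S {v} {w} h =
    length-filter-< _ _ proj₁ (∈-cartesianProduct⁺ (∈-vertices v) (∈-vertices w)) h
                    (λ (_ , ¬e) → ¬e (inj₁ (refl , refl)))

  A-neighbour : ∀ {H} → Subgraph H → V → V → Bool
  A-neighbour S u w = does (decide S u w) ∧ A w

  oddA : ∀ {H} → Subgraph H → V → Bool
  oddA S u = xors (map (A-neighbour S u) (neighbours u))

  EvenOutside : ∀ {H} → Subgraph H → Set
  EvenOutside S = ∀ u → A u ≡ false → oddA S u ≡ false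

  private
    A-neighbour-cong : ∀ {H H'} (S : Subgraph H) (S' : Subgraph H') {u w} →
                       (H u w → H' u w) → (H' u w → H u w) → A-neighbour S u w ≡ A-neighbour S' u w
    A-neighbour-cong S S' {u} {w} to from =
      cong (_∧ A w) (does-⇔ (mk⇔ to from) (decide S u w) (decide S' u w))

    ≢-by-A : ∀ {p q} → A p ≡ false → A q ≡ true → p ≢ q
    ≢-by-A Ap Aq refl with () ← trans (sym Ap) Aq

  oddA-delete-self : ∀ {H} (S : Subgraph H) {u w} → H u w → A w ≡ true →
                     oddA (delete S u w) u ≡ not (oddA S u)
  oddA-delete-self S {u} {w} Huw Aw =
    xors-flip (A-neighbour S u) (A-neighbour (delete S u w) u)
              (neighbours-unique u) (neighbours-complete (⊆H₀ S Huw)) flipped unchanged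
    where
    flipped : A-neighbour (delete S u w) u w ≡ not (A-neighbour S u w)
    flipped rewrite dec-false (decide (delete S u w) u w) (λ (_ , ¬e) → ¬e (inj₁ (refl , refl)))
                  | dec-true (decide S u w) Huw | Aw = refl
    unchanged : ∀ w' → w' ≢ w → A-neighbour (delete S u w) u w' ≡ A-neighbour S u w'
    unchanged w' w'≢w = A-neighbour-cong (delete S u w) S proj₁
      (λ h → h , [ w'≢w ∘ proj₂ , (λ (u≡w , w'≡u) → w'≢w (trans w'≡u u≡w)) ])

  oddA-delete-other : ∀ {H} (S : Subgraph H) {u w u'} → u' ≢ u → u' ≢ w →
                      oddA (delete S u w) u' ≡ oddA S u'
  oddA-delete-other S {u} {w} {u'} u'≢u u'≢w = xors-cong {xs = neighbours u'} (All.tabulate λ {w'} _ →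
    A-neighbour-cong (delete S u w) S {u'} {w'} proj₁
                     (λ h → h , [ u'≢u ∘ proj₁ , u'≢w ∘ proj₁ ]))

  oddA-delete-swap : ∀ {H} (S : Subgraph H) v w u → oddA (delete S v w) u ≡ oddA (delete S w v) u
  oddA-delete-swap S v w u = xors-cong {xs = neighbours u} (All.tabulate λ {w'} _ →
    A-neighbour-cong (delete S v w) (delete S w v) {u} {w'}
                     (Prod.map₂ (_∘ Sum.swap)) (Prod.map₂ (_∘ Sum.swap)))

  oddA-witness : ∀ {H} (S : Subgraph H) {u} → oddA S u ≡ true → ∃[ w ] H u w × A w ≡ true
  oddA-witness S {u} odd with xors-true (A-neighbour S u) (neighbours u) odd
  ... | w , _ , w-counts with decide S u w | A w in Aw
  ...   | yes Huw | true = w , Huw , Aw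

  evenOutside-delete : ∀ {H} (S : Subgraph H) {u w} → H u w → A w ≡ true → oddA S u ≡ true →
                       (∀ u' → u' ≢ u → A u' ≡ false → oddA S u' ≡ false) →
                       EvenOutside (delete S u w)
  evenOutside-delete S {u} {w} Huw Aw odd elsewhere u' Au' = by-cases (u' ≟ u)
    where
    by-cases : Dec (u' ≡ u) → oddA (delete S u w) u' ≡ false
    by-cases (yes refl) = trans (oddA-delete-self S Huw Aw) (cong not odd)
    by-cases (no u'≢u)  = trans (oddA-delete-other S u'≢u (≢-by-A Au' Aw)) (elsewhere u' u'≢u Au')

  evenOutside⇒IsP : ∀ {H} (S : Subgraph H) → EvenOutside S → ∀ {x} → A x ≡ true → IsP H x
  evenOutside⇒IsP S = bounded (suc (edgeCount S)) S ≤-refl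
    where
    bounded : ∀ k {H} (S : Subgraph H) → edgeCount S < k → EvenOutside S →
              ∀ {x} → A x ≡ true → IsP H x
    bounded (suc k) {H} S bound even {x} Ax = lose reply
      where
      reply : ∀ u → H x u → IsN (deleteEdge H x u) u
      reply u Hxu = respond (oddA-witness S₁ odd₁)
        where
        open ≡-Reasoning
        Au : A u ≡ false
        Au = A-independent (⊆H₀ S Hxu) Ax
        S₁ : Subgraph (deleteEdge H x u)
        S₁ = delete S x u
        odd₁ : oddA S₁ u ≡ true
        odd₁ = begin
          oddA S₁ u              ≡⟨ oddA-delete-swap S x u u ⟩
          oddA (delete S u x) u  ≡⟨ oddA-delete-self S (symmetric S Hxu) Ax ⟩
          not (oddA S u)         ≡⟨ cong not (even u Au) ⟩
          true                   ∎
        even₁ : ∀ u' → u' ≢ u → A u' ≡ false → oddA S₁ u' ≡ false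
        even₁ u' u'≢u Au' = begin
          oddA S₁ u'              ≡⟨ oddA-delete-swap S x u u' ⟩
          oddA (delete S u x) u'  ≡⟨ oddA-delete-other S u'≢u (≢-by-A Au' Ax) ⟩
          oddA S u'               ≡⟨ even u' Au' ⟩
          false                   ∎
        respond : ∃[ y ] deleteEdge H x u u y × A y ≡ true → IsN (deleteEdge H x u) u
        respond (y , H₁uy , Ay) =
          win y H₁uy (bounded k (delete S₁ u y) bound₂ (evenOutside-delete S₁ H₁uy Ay odd₁ even₁) Ay)
          where
          bound₂ : edgeCount (delete S₁ u y) < k
          bound₂ = <-≤-trans (<-trans (edgeCount-delete S₁ H₁uy) (edgeCount-delete S Hxu))
                             (≤-pred bound)

  oddAt⇒IsN : ∀ {H} (S : Subgraph H) {v} → oddA S v ≡ true →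
              (∀ u → u ≢ v → A u ≡ false → oddA S u ≡ false) → IsN H v
  oddAt⇒IsN S odd even with oddA-witness S odd
  ... | w , Hvw , Aw = win w Hvw (evenOutside⇒IsP (delete S _ w) (evenOutside-delete S Hvw Aw odd even) Aw)

IsN⇒¬IsP : ∀ {V} {H : Graph V} {v} → IsN H v → ¬ IsP H v
IsN⇒¬IsP (win w Hvw P) (lose N) = IsN⇒¬IsP (N w Hvw) P

-- The mod-2 Laplacian on ℕ²

≡ᵇ-true : ∀ {m n} → (m ≡ᵇ n) ≡ true → m ≡ n
≡ᵇ-true {m} {n} e = ≡ᵇ⇒≡ m n (subst T (sym e) tt)

<ᵇ-true : ∀ {m n} → (m <ᵇ n) ≡ true → m < n
<ᵇ-true {m} {n} e = <ᵇ⇒< m n (subst T (sym e) tt)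

<ᵇ-false : ∀ {m n} → (m <ᵇ n) ≡ false → n ≤ m
<ᵇ-false {m} {n} e = ≮⇒≥ (λ m<n → subst T e (subst T (sym (dec-true (m <? n) m<n)) tt))

∧-≡ᵇ-subst : ∀ (f : ℕ → Bool) z c → f z ∧ (z ≡ᵇ c) ≡ f c ∧ (z ≡ᵇ c)
∧-≡ᵇ-subst f z c with z ≡ᵇ c in z≡c
... | true  = cong (λ w → f w ∧ true) (≡ᵇ-true z≡c)
... | false = trans (∧-zeroʳ (f z)) (sym (∧-zeroʳ (f c)))

pred-≡ᵇ-suc : ∀ z x → (pred z ≡ᵇ suc x) ≡ (z ≡ᵇ suc (suc x))
pred-≡ᵇ-suc zero    x = refl
pred-≡ᵇ-suc (suc z) x = refl

xor-cancel-middle : ∀ a b c → (a xor b) xor (b xor c) ≡ a xor c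
xor-cancel-middle a b c =
  trans (xor-assoc a b (b xor c)) (cong (a xor_) (trans (sym (xor-assoc b b c)) (cong (_xor c) (xor-same b))))

xorUpTo : ℕ → (ℕ → Bool) → Bool
xorUpTo zero    f = false
xorUpTo (suc T) f = f T xor xorUpTo T f

xorUpTo-cong : ∀ T {f g : ℕ → Bool} → (∀ t → f t ≡ g t) → xorUpTo T f ≡ xorUpTo T g
xorUpTo-cong zero    f≗g = refl
xorUpTo-cong (suc T) f≗g = cong₂ _xor_ (f≗g T) (xorUpTo-cong T f≗g)

xorUpTo-false : ∀ T {f : ℕ → Bool} → (∀ t → f t ≡ false) → xorUpTo T f ≡ false
xorUpTo-false zero    f≗0 = refl
xorUpTo-false (suc T) f≗0 = cong₂ _xor_ (f≗0 T) (xorUpTo-false T f≗0)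

xorUpTo-xor : ∀ T (f g : ℕ → Bool) → xorUpTo T (λ t → f t xor g t) ≡ xorUpTo T f xor xorUpTo T g
xorUpTo-xor zero    f g = refl
xorUpTo-xor (suc T) f g =
  trans (cong ((f T xor g T) xor_) (xorUpTo-xor T f g)) (xor-interchange (f T) (g T) _ _)

xorUpTo-telescope : ∀ T (h : ℕ → Bool) → xorUpTo T (λ t → h (suc t) xor h t) ≡ h T xor h 0
xorUpTo-telescope zero    h = sym (xor-same (h 0))
xorUpTo-telescope (suc T) h =
  trans (cong ((h (suc T) xor h T) xor_) (xorUpTo-telescope T h)) (xor-cancel-middle (h (suc T)) (h T) (h 0))

xorDiagonal : ℕ → (ℕ → ℕ → Bool) → Bool
xorDiagonal zero    f = f 0 0
xorDiagonal (suc k) f = f 0 (suc k) xor xorDiagonal k (λ p → f (suc p))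

xorDiagonal-cong : ∀ k {f g : ℕ → ℕ → Bool} → (∀ p q → f p q ≡ g p q) →
                   xorDiagonal k f ≡ xorDiagonal k g
xorDiagonal-cong zero    f≗g = f≗g 0 0
xorDiagonal-cong (suc k) f≗g = cong₂ _xor_ (f≗g 0 (suc k)) (xorDiagonal-cong k (λ p → f≗g (suc p)))

xorDiagonal-false : ∀ k {f : ℕ → ℕ → Bool} → (∀ p q → f p q ≡ false) → xorDiagonal k f ≡ false
xorDiagonal-false zero    f≗0 = f≗0 0 0
xorDiagonal-false (suc k) f≗0 = cong₂ _xor_ (f≗0 0 (suc k)) (xorDiagonal-false k (λ p → f≗0 (suc p)))

xorDiagonal-xor : ∀ k (f g : ℕ → ℕ → Bool) →
                  xorDiagonal k (λ p q → f p q xor g p q) ≡ xorDiagonal k f xor xorDiagonal k g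
xorDiagonal-xor zero    f g = refl
xorDiagonal-xor (suc k) f g =
  trans (cong ((f 0 (suc k) xor g 0 (suc k)) xor_) (xorDiagonal-xor k (λ p → f (suc p)) (λ p → g (suc p))))
        (xor-interchange (f 0 (suc k)) (g 0 (suc k)) _ _)

xorDiagonal-telescope : ∀ k (g : ℕ → ℕ → Bool) →
                        xorDiagonal k (λ p q → g p (suc q) xor g (suc p) q) ≡ g 0 (suc k) xor g (suc k) 0
xorDiagonal-telescope zero    g = refl
xorDiagonal-telescope (suc k) g =
  trans (cong ((g 0 (suc (suc k)) xor g 1 (suc k)) xor_) (xorDiagonal-telescope k (λ p → g (suc p))))
        (xor-cancel-middle (g 0 (suc (suc k))) (g 1 (suc k)) (g (suc (suc k)) 0))

-- Mod 2 the Laplacian of the lattice and its adjacency operator agree, every point having degree 4.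
Lap : (ℕ → ℕ → Bool) → ℕ → ℕ → Bool
Lap F x y = (F (suc x) y xor F (pred x) y) xor (F x (suc y) xor F x (pred y))

Lap-linear : ∀ {I : Set} (Σ : (I → Bool) → Bool) → (∀ f g → Σ (λ i → f i xor g i) ≡ Σ f xor Σ g) →
             ∀ (F : I → ℕ → ℕ → Bool) x y →
             Lap (λ x y → Σ (λ i → F i x y)) x y ≡ Σ (λ i → Lap (F i) x y)
Lap-linear Σ Σ-xor F x y = sym (trans (Σ-xor _ _) (cong₂ _xor_ (Σ-xor _ _) (Σ-xor _ _)))

Lap-dAlembert : ∀ (γ η : ℕ → Bool) p q →
                Lap (λ p q → γ ∣ p - q ∣ xor η (p + q)) (suc p) (suc q) ≡ false
Lap-dAlembert γ η p q rewrite +-suc p (suc q) | +-suc p q =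
  halves-cancel (γ ∣ suc p - q ∣) (η (suc (suc (suc (p + q))))) (γ ∣ p - suc q ∣) (η (suc (p + q)))
  where
  halves-cancel : ∀ a b c e → ((a xor b) xor (c xor e)) xor ((c xor b) xor (a xor e)) ≡ false
  halves-cancel a b c e = trans (cong (((a xor b) xor (c xor e)) xor_) swap) (xor-same ((a xor b) xor (c xor e)))
    where
    open ≡-Reasoning
    swap : (c xor b) xor (a xor e) ≡ (a xor b) xor (c xor e)
    swap = begin
      (c xor b) xor (a xor e) ≡⟨ xor-interchange c b a e ⟩
      (c xor a) xor (b xor e) ≡⟨ cong (_xor (b xor e)) (xor-comm c a) ⟩
      (a xor c) xor (b xor e) ≡⟨ xor-interchange a c b e ⟩
      (a xor b) xor (c xor e) ∎

-- The sum of f over the lattice points (1 + t + p, 1 + t + q + b) with p + q = k and t < T, that is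
-- over the first T points of the k + 1 diagonal rays starting at (1, 1 + k + b), …, (1 + k, 1 + b).
parallelogramSum : (k b T : ℕ) → (ℕ → ℕ → Bool) → Bool
parallelogramSum k b T f = xorDiagonal k (λ p q → xorUpTo T (λ t → f (suc (t + p)) (suc (t + (q + b)))))

parallelogramSum-xor : ∀ k b T (f g : ℕ → ℕ → Bool) → parallelogramSum k b T (λ X Y → f X Y xor g X Y)
                       ≡ parallelogramSum k b T f xor parallelogramSum k b T g
parallelogramSum-xor k b T f g = trans (xorDiagonal-cong k (λ p q → xorUpTo-xor T _ _)) (xorDiagonal-xor k _ _)

parallelogramSum-cong : ∀ k b T {f g : ℕ → ℕ → Bool} →
                        (∀ X Y → f (suc X) (suc Y) ≡ g (suc X) (suc Y)) →
                        parallelogramSum k b T f ≡ parallelogramSum k b T g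
parallelogramSum-cong k b T f≗g = xorDiagonal-cong k (λ p q → xorUpTo-cong T (λ t → f≗g _ _))

parallelogramSum-false : ∀ k b T {f : ℕ → ℕ → Bool} → (∀ X Y → f X Y ≡ false) →
                         parallelogramSum k b T f ≡ false
parallelogramSum-false k b T f≗0 = xorDiagonal-false k (λ p q → xorUpTo-false T (λ t → f≗0 _ _))

Lap-parallelogram : ∀ k b T (D : ℕ → ℕ → Bool) → parallelogramSum k b T (Lap D)
  ≡ (D (T + 0) (T + (suc k + b)) xor D (T + suc k) (T + b)) xor (D 0 (suc k + b) xor D (suc k) b)
Lap-parallelogram k b T D = begin
  parallelogramSum k b T (Lap D)
    ≡⟨ xorDiagonal-cong k (λ p q →
         trans (xorUpTo-cong T (λ t → ray-step p q t)) (xorUpTo-telescope T (back p q))) ⟩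
  xorDiagonal k (λ p q → back p q T xor back p q 0)
    ≡⟨ xorDiagonal-xor k _ _ ⟩
  xorDiagonal k (λ p q → back p q T) xor xorDiagonal k (λ p q → back p q 0)
    ≡⟨ cong₂ _xor_ (trans (xorDiagonal-cong k far-end)
                          (xorDiagonal-telescope k (λ p q → D (T + p) (T + (q + b)))))
                   (xorDiagonal-telescope k (λ p q → D p (q + b))) ⟩
  (D (T + 0) (T + (suc k + b)) xor D (T + suc k) (T + b)) xor (D 0 (suc k + b) xor D (suc k) b) ∎
  where
  open ≡-Reasoning
  back : ℕ → ℕ → ℕ → Bool
  back p q t = D (t + p) (suc (t + (q + b))) xor D (suc (t + p)) (t + (q + b))
  ray-step : ∀ p q t → Lap D (suc (t + p)) (suc (t + (q + b))) ≡ back p q (suc t) xor back p q t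
  ray-step p q t = trans (xor-interchange (D (suc X) Y) (D (t + p) Y) (D X (suc Y)) (D X (t + (q + b))))
                         (cong (_xor back p q t) (xor-comm (D (suc X) Y) (D X (suc Y))))
    where
    X = suc (t + p)
    Y = suc (t + (q + b))
  far-end : ∀ p q → back p q T ≡ D (T + p) (T + suc (q + b)) xor D (T + suc p) (T + (q + b))
  far-end p q = sym (cong₂ _xor_ (cong (D (T + p)) (+-suc T (q + b)))
                                 (cong (λ X → D X (T + (q + b))) (+-suc T p)))

-- Folding ℕ onto [0, P]

module Folding (P : ℕ) (P>0 : 0 < P) where

  interior : ℕ → Bool
  interior z = (0 <ᵇ z) ∧ (z <ᵇ P)

  interior-true : ∀ {z} → 0 < z → z < P → interior z ≡ true
  interior-true {suc z} _ z<P = dec-true (suc z <? P) z<P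

  interior⇒< : ∀ {z} → interior z ≡ true → z < P
  interior⇒< {suc z} e = <ᵇ-true e

  interior⇒> : ∀ {z} → interior z ≡ true → 0 < z
  interior⇒> {suc z} _ = s≤s z≤n

  interior-false : ∀ {z} → z ≤ P → interior z ≡ false → z ≡ 0 ⊎ z ≡ P
  interior-false {zero}  _   _ = inj₁ refl
  interior-false {suc z} z≤P e = inj₂ (≤-antisym z≤P (<ᵇ-false e))

  interior-P : interior P ≡ false
  interior-P = trans (cong ((0 <ᵇ P) ∧_) (dec-false (P <? P) (<-irrefl refl))) (∧-zeroʳ (0 <ᵇ P))

  -- fold X is the position at time X of a ball bouncing with unit speed between the walls 0 and P,
  -- that is the triangle wave 0, 1, …, P, P − 1, …, 0, 1, …; the Bool says whether the ball rises.
  step : ℕ × Bool → ℕ × Bool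
  step (z , true)  = suc z , (suc z <ᵇ P)
  step (z , false) = pred z , (pred z ≡ᵇ 0)

  bounce : ℕ → ℕ × Bool
  bounce zero    = 0 , true
  bounce (suc X) = step (bounce X)

  fold : ℕ → ℕ
  fold X = proj₁ (bounce X)

  Consistent : ℕ → ℕ × Bool → Set
  Consistent X (z , true)  = z < P × ∃[ k ] X ≡ k * P + z
  Consistent X (z , false) = 0 < z × z ≤ P × ∃[ k ] X + z ≡ k * P

  bounce-consistent : ∀ X → Consistent X (bounce X)
  bounce-consistent zero = P>0 , 0 , refl
  bounce-consistent (suc X) with bounce X | bounce-consistent X
  ... | z , true | z<P , k , X≡ with suc z <ᵇ P in rising
  ...   | true  = <ᵇ-true rising , k , trans (cong suc X≡) (sym (+-suc (k * P) z))
  ...   | false = s≤s z≤n , z<P , suc (suc k) , turn (≤-antisym z<P (<ᵇ-false rising))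
    where
    turn : suc z ≡ P → suc X + suc z ≡ suc (suc k) * P
    turn refl rewrite X≡ = arithmetic k z
      where
      arithmetic : ∀ k z → suc (k * suc z + z) + suc z ≡ suc (suc k) * suc z
      arithmetic = solve-∀
  bounce-consistent (suc X) | zero , false | () , _
  bounce-consistent (suc X) | suc zero , false | _ , _ , k , X+1≡ =
    P>0 , k , trans (trans (+-comm 1 X) X+1≡) (sym (+-identityʳ (k * P)))
  bounce-consistent (suc X) | suc (suc z) , false | _ , z+2≤P , k , X+z+2≡ =
    s≤s z≤n , ≤-trans (n≤1+n _) z+2≤P , k , trans (sym (+-suc X (suc z))) X+z+2≡

  fold-≤ : ∀ X → fold X ≤ P
  fold-≤ X with bounce X | bounce-consistent X
  ... | z , true  | z<P , _     = <⇒≤ z<P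
  ... | z , false | _ , z≤P , _ = z≤P

  wall⇒∣ : ∀ X → interior (fold X) ≡ false → P ∣ X
  wall⇒∣ X wall with bounce X | bounce-consistent X
  ... | z , true | z<P , k , X≡ with interior-false (<⇒≤ z<P) wall
  ...   | inj₁ refl = divides k (trans X≡ (+-identityʳ (k * P)))
  ...   | inj₂ refl = ⊥-elim (<-irrefl refl z<P)
  wall⇒∣ X wall | z , false | 0<z , z≤P , k , X+z≡ with interior-false z≤P wall
  ...   | inj₁ refl = ⊥-elim (<-irrefl refl 0<z)
  ...   | inj₂ refl = ∣m+n∣m⇒∣n (divides k (trans (+-comm P X) X+z≡)) ∣-refl

  ∤⇒interior : ∀ X → ¬ P ∣ X → interior (fold X) ≡ true
  ∤⇒interior X P∤X with interior (fold X) in wall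
  ... | true  = refl
  ... | false = ⊥-elim (P∤X (wall⇒∣ X wall))

  ∣⇒wall : ∀ X → P ∣ X → interior (fold X) ≡ false
  ∣⇒wall X P∣X with bounce X | bounce-consistent X
  ... | zero  , true | _ = refl
  ... | suc z , true | z<P , k , X≡ =
    ⊥-elim (<⇒≱ z<P (∣⇒≤ (∣m+n∣m⇒∣n (subst (P ∣_) X≡ P∣X) (n∣m*n k))))
  ∣⇒wall X P∣X | zero , false | () , _
  ∣⇒wall X P∣X | suc z , false | _ , z≤P , k , X+z≡
    rewrite ≤-antisym z≤P (∣⇒≤ (∣m+n∣m⇒∣n (divides k X+z≡) P∣X)) =
    dec-false (P <? P) (<-irrefl refl)

  bounce-rising : ∀ X → X < P → bounce X ≡ (X , true)
  bounce-rising zero    _   = refl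
  bounce-rising (suc X) X<P rewrite bounce-rising X (<-trans (n<1+n X) X<P) =
    cong (suc X ,_) (dec-true (suc X <? P) X<P)

  fold-< : ∀ {X} → X < P → fold X ≡ X
  fold-< {X} X<P = cong proj₁ (bounce-rising X X<P)

  fold-adjacent : ∀ (g : ℕ → Bool) X → g (fold (suc (suc X))) xor g (fold X)
                  ≡ interior (fold (suc X)) ∧ (g (suc (fold (suc X))) xor g (pred (fold (suc X))))
  fold-adjacent g X with bounce X | bounce-consistent X
  ... | z , true | _ with suc z <ᵇ P
  ...   | true  = refl
  ...   | false = xor-same (g z)
  fold-adjacent g X | zero , false | () , _
  fold-adjacent g X | suc zero , false | _ = xor-same (g 1)
  fold-adjacent g X | suc (suc z) , false | _ , z+2≤P , _
    rewrite interior-true {suc z} (s≤s z≤n) z+2≤P = xor-comm (g z) (g (suc (suc z)))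

  visits : ℕ → ℕ → Bool
  visits x X = interior x ∧ (fold X ≡ᵇ x)

  visits-wall : ∀ x {X} → P ∣ X → visits x X ≡ false
  visits-wall x {X} P∣X rewrite sym (∧-≡ᵇ-subst interior (fold X) x) | ∣⇒wall X P∣X = refl

  visits-P : ∀ X → visits P X ≡ false
  visits-P X = cong (_∧ (fold X ≡ᵇ P)) interior-P

  visits-< : ∀ {x X} → interior x ≡ true → X < P → visits x X ≡ (X ≡ᵇ x)
  visits-< x° X<P rewrite x° | fold-< X<P = refl

  visits-adjacent : ∀ x X → interior (suc x) ≡ true →
                    visits (suc (suc x)) (suc X) xor visits x (suc X)
                    ≡ visits (suc x) (suc (suc X)) xor visits (suc x) X
  visits-adjacent x X x° = begin
    visits (suc (suc x)) (suc X) xor visits x (suc X)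
      ≡⟨ xor-comm (visits (suc (suc x)) (suc X)) _ ⟩
    (interior x ∧ (z ≡ᵇ x)) xor (interior (suc (suc x)) ∧ (z ≡ᵇ suc (suc x)))
      ≡⟨ sym (cong₂ _xor_ (∧-≡ᵇ-subst interior z x) (∧-≡ᵇ-subst interior z (suc (suc x)))) ⟩
    (interior z ∧ (z ≡ᵇ x)) xor (interior z ∧ (z ≡ᵇ suc (suc x)))
      ≡⟨ sym (∧-distribˡ-xor (interior z) _ _) ⟩
    interior z ∧ ((suc z ≡ᵇ suc x) xor (z ≡ᵇ suc (suc x)))
      ≡⟨ cong (λ b → interior z ∧ ((suc z ≡ᵇ suc x) xor b)) (sym (pred-≡ᵇ-suc z x)) ⟩
    interior z ∧ ((suc z ≡ᵇ suc x) xor (pred z ≡ᵇ suc x))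
      ≡⟨ sym (fold-adjacent (_≡ᵇ suc x) X) ⟩
    (fold (suc (suc X)) ≡ᵇ suc x) xor (fold X ≡ᵇ suc x)
      ≡⟨ sym (cong₂ (λ b b' → (b ∧ (fold (suc (suc X)) ≡ᵇ suc x)) xor (b' ∧ (fold X ≡ᵇ suc x)))
                    x° x°) ⟩
    visits (suc x) (suc (suc X)) xor visits (suc x) X ∎
    where
    open ≡-Reasoning
    z = fold (suc X)

module Unfolding (P Q : ℕ) (P>0 : 0 < P) (Q>0 : 0 < Q) where
  module FP = Folding P P>0
  module FQ = Folding Q Q>0

  -- Away from the walls folding is a local isometry; at a wall the two neighbours across it fold to
  -- the same point and cancel, while G vanishes along the wall.
  pullback-harmonic : (G : ℕ → ℕ → Bool) →
    (∀ p q → p ≤ P → q ≤ Q → FP.interior p ≡ false → G p q ≡ false) →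
    (∀ p q → p ≤ P → q ≤ Q → FQ.interior q ≡ false → G p q ≡ false) →
    (∀ p q → FP.interior p ≡ true → FQ.interior q ≡ true → Lap G p q ≡ false) →
    ∀ X Y → Lap (λ X Y → G (FP.fold X) (FQ.fold Y)) (suc X) (suc Y) ≡ false
  pullback-harmonic G wallˣ wallʸ harmonic X Y =
    trans (cong₂ _xor_ (FP.fold-adjacent (λ p → G p (FQ.fold (suc Y))) X)
                       (FQ.fold-adjacent (G (FP.fold (suc X))) Y))
          (masked (FP.fold (suc X)) (FQ.fold (suc Y)) (FP.fold-≤ (suc X)) (FQ.fold-≤ (suc Y)))
    where
    masked : ∀ p q → p ≤ P → q ≤ Q →
             (FP.interior p ∧ (G (suc p) q xor G (pred p) q)) xor
             (FQ.interior q ∧ (G p (suc q) xor G p (pred q))) ≡ false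
    masked p q p≤P q≤Q with FP.interior p in p° | FQ.interior q in q°
    ... | true  | true  = harmonic p q p° q°
    ... | false | false = refl
    ... | false | true
      rewrite wallˣ p (suc q) p≤P (FQ.interior⇒< q°) p°
            | wallˣ p (pred q) p≤P (≤-trans pred[n]≤n q≤Q) p° = refl
    ... | true  | false
      rewrite wallʸ (suc p) q (FP.interior⇒< p°) q≤Q q°
            | wallʸ (pred p) q (≤-trans pred[n]≤n p≤P) q≤Q q° = refl

  -- Dually, the Laplacian of the folded image of a lattice point is the folded image of its Laplacian.
  pushforward-Lap : ∀ x y X Y → FP.interior (suc x) ≡ true → FQ.interior (suc y) ≡ true →
    Lap (λ x y → FP.visits x (suc X) ∧ FQ.visits y (suc Y)) (suc x) (suc y)
    ≡ Lap (λ X Y → FP.visits (suc x) X ∧ FQ.visits (suc y) Y) (suc X) (suc Y)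
  pushforward-Lap x y X Y x° y° = cong₂ _xor_
    (trans (sym (∧-distribʳ-xor v (FP.visits (suc (suc x)) (suc X)) (FP.visits x (suc X))))
           (trans (cong (_∧ v) (FP.visits-adjacent x X x°))
                  (∧-distribʳ-xor v (FP.visits (suc x) (suc (suc X))) (FP.visits (suc x) X))))
    (trans (sym (∧-distribˡ-xor h (FQ.visits (suc (suc y)) (suc Y)) (FQ.visits y (suc Y))))
           (trans (cong (h ∧_) (FQ.visits-adjacent y Y y°))
                  (∧-distribˡ-xor h (FQ.visits (suc y) (suc (suc Y))) (FQ.visits (suc y) Y))))
    where
    h = FP.visits (suc x) (suc X)
    v = FQ.visits (suc y) (suc Y)

-- Dirichlet problems for Lap on the box [0, m + 1] × [0, n + 1]

record Solution (m n : ℕ) (target : ℕ → ℕ → Bool) : Set where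
  field
    F        : ℕ → ℕ → Bool
    F-left   : ∀ y → F 0 y ≡ false
    F-right  : ∀ y → F (suc m) y ≡ false
    F-bottom : ∀ x → F x 0 ≡ false
    F-top    : ∀ x → F x (suc n) ≡ false
    Lap-F    : ∀ x y → x < m → y < n → Lap F (suc x) (suc y) ≡ target (suc x) (suc y)

transpose : ∀ {m n target} → Solution n m target → Solution m n (λ x y → target y x)
transpose S = record
  { F = λ x y → F y x ; F-left = F-bottom ; F-right = F-top ; F-bottom = F-left ; F-top = F-right
  ; Lap-F = λ x y x<m y<n →
      trans (xor-comm (F (suc y) (suc (suc x)) xor F (suc y) x) _) (Lap-F y x y<n x<m)
  }
  where open Solution S

retarget : ∀ {m n target target'} → (∀ x y → target x y ≡ target' x y) →
           Solution m n target → Solution m n target'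
retarget target≗ S = record
  { F = F ; F-left = F-left ; F-right = F-right ; F-bottom = F-bottom ; F-top = F-top
  ; Lap-F = λ x y x<m y<n → trans (Lap-F x y x<m y<n) (target≗ (suc x) (suc y))
  }
  where open Solution S

point : ℕ → ℕ → ℕ → ℕ → Bool
point a b x y = (a ≡ᵇ x) ∧ (b ≡ᵇ y)

point-self : ∀ a b → point a b a b ≡ true
point-self a b = cong₂ _∧_ (dec-true (a ≟ a) refl) (dec-true (b ≟ b) refl)

point-other : ∀ {a b x y} → (a , b) ≢ (x , y) → point a b x y ≡ false
point-other {a} {b} {x} {y} ab≢xy with a ≡ᵇ x in a≡x | b ≡ᵇ y in b≡y
... | true  | true  = ⊥-elim (ab≢xy (cong₂ _,_ (≡ᵇ-true a≡x) (≡ᵇ-true b≡y)))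
... | true  | false = refl
... | false | _     = refl

∣m-n∣<m+n : ∀ {m n} → 0 < m → 0 < n → ∣ m - n ∣ < m + n
∣m-n∣<m+n {suc m} {suc n} _ _ =
  s≤s (≤-trans (≤-trans (∣m-n∣≤m⊔n m n) (m⊔n≤m+n m n)) (+-monoʳ-≤ m (n≤1+n n)))

m+n+∣m-n∣≡2[m⊔n] : ∀ m n → m + n + ∣ m - n ∣ ≡ (m ⊔ n) + (m ⊔ n)
m+n+∣m-n∣≡2[m⊔n] zero    n       = refl
m+n+∣m-n∣≡2[m⊔n] (suc m) zero    = cong (_+ suc m) (+-identityʳ (suc m))
m+n+∣m-n∣≡2[m⊔n] (suc m) (suc n) = cong suc (begin
  m + suc n + ∣ m - n ∣    ≡⟨ cong (_+ ∣ m - n ∣) (+-suc m n) ⟩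
  suc (m + n + ∣ m - n ∣)  ≡⟨ cong suc (m+n+∣m-n∣≡2[m⊔n] m n) ⟩
  suc ((m ⊔ n) + (m ⊔ n))  ≡⟨ sym (+-suc (m ⊔ n) (m ⊔ n)) ⟩
  (m ⊔ n) + suc (m ⊔ n)    ∎)
  where open ≡-Reasoning

m+n+o≡m+m⇔m∸n≡o : ∀ {m n o} → n ≤ m → m + n + o ≡ m + m ⇔ m ∸ n ≡ o
m+n+o≡m+m⇔m∸n≡o {m} {n} {o} n≤m = mk⇔
  (λ e → trans (cong (_∸ n) (sym (+-cancelˡ-≡ m _ _ (trans (sym (+-assoc m n o)) e)))) (m+n∸m≡n n o))
  (λ e → trans (+-assoc m n o) (cong (m +_) (trans (cong (n +_) (sym e)) (m+[n∸m]≡n n≤m))))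

module BilliardPath (d α β : ℕ) (α<d : α < d) (β<d : β < d) where

  c : ℕ
  c = ∣ α - β ∣

  c<d : c < d
  c<d = ≤-<-trans (∣m-n∣≤m⊔n α β) (⊔-lub α<d β<d)

  α+β+c<d+d : α + β + c < d + d
  α+β+c<d+d =
    subst (_< d + d) (sym (m+n+∣m-n∣≡2[m⊔n] α β)) (+-mono-< (⊔-lub α<d β<d) (⊔-lub α<d β<d))

  -- The closed billiard path of the square [0, d]² around the rectangle with corners (c, 0),
  -- (d, d − c), (d − c, d) and (0, c), whose sides lie on the lines p − q = ±c, p + q = c and
  -- p + q = 2d − c.
  path : ℕ → ℕ → Bool
  path p q = (∣ p - q ∣ ≡ᵇ c) xor ((p + q ≡ᵇ c) xor (p + q + c ≡ᵇ d + d))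

  path-harmonic : ∀ p q → Lap path (suc p) (suc q) ≡ false
  path-harmonic = Lap-dAlembert (_≡ᵇ c) (λ s → (s ≡ᵇ c) xor (s + c ≡ᵇ d + d))

  path-sym : ∀ p q → path p q ≡ path q p
  path-sym p q rewrite ∣-∣-comm p q | +-comm p q = refl

  path-left : ∀ q → q ≤ d → path 0 q ≡ false
  path-left q q≤d = begin
    (q ≡ᵇ c) xor ((q ≡ᵇ c) xor (q + c ≡ᵇ d + d))
      ≡⟨ sym (xor-assoc (q ≡ᵇ c) (q ≡ᵇ c) _) ⟩
    ((q ≡ᵇ c) xor (q ≡ᵇ c)) xor (q + c ≡ᵇ d + d)
      ≡⟨ cong (_xor (q + c ≡ᵇ d + d)) (xor-same (q ≡ᵇ c)) ⟩
    q + c ≡ᵇ d + d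
      ≡⟨ dec-false (q + c ≟ d + d) (<⇒≢ (+-mono-≤-< q≤d c<d)) ⟩
    false ∎
    where open ≡-Reasoning

  path-right : ∀ q → q ≤ d → path d q ≡ false
  path-right q q≤d
    rewrite m≤n⇒∣n-m∣≡n∸m q≤d
          | dec-false (d + q ≟ c) (>⇒≢ (≤-trans c<d (m≤m+n d q)))
          | does-⇔ (m+n+o≡m+m⇔m∸n≡o q≤d) (d + q + c ≟ d + d) (d ∸ q ≟ c) =
    xor-same (d ∸ q ≡ᵇ c)

  path-through : 0 < α → 0 < β → path α β ≡ true
  path-through 0<α 0<β
    rewrite dec-true (c ≟ c) refl
          | dec-false (α + β ≟ c) (>⇒≢ (∣m-n∣<m+n 0<α 0<β))
          | dec-false (α + β + c ≟ d + d) (<⇒≢ α+β+c<d+d) = refl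

P-solution : ∀ {m n} a b → ¬ gcd (suc m) (suc n) ∣ suc a → ¬ gcd (suc m) (suc n) ∣ suc b →
             Σ[ S ∈ Solution m n (λ _ _ → false) ] Solution.F S (suc a) (suc b) ≡ true
P-solution {m} {n} a b d∤a d∤b = solution , path-through (interior⇒> α°) (interior⇒> β°)
  where
  d = gcd (suc m) (suc n)
  d>0 : 0 < d
  d>0 = n≢0⇒n>0 (gcd[m,n]≢0 (suc m) (suc n) (inj₁ λ ()))
  open Folding d d>0
  open Unfolding d d d>0 d>0 using (pullback-harmonic)
  α° : interior (fold (suc a)) ≡ true
  α° = ∤⇒interior (suc a) d∤a
  β° : interior (fold (suc b)) ≡ true
  β° = ∤⇒interior (suc b) d∤b
  open BilliardPath d (fold (suc a)) (fold (suc b)) (interior⇒< α°) (interior⇒< β°)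

  wallˣ : ∀ p q → p ≤ d → q ≤ d → interior p ≡ false → path p q ≡ false
  wallˣ p q p≤d q≤d p° with interior-false p≤d p°
  ... | inj₁ refl = path-left q q≤d
  ... | inj₂ refl = path-right q q≤d

  wallʸ : ∀ p q → p ≤ d → q ≤ d → interior q ≡ false → path p q ≡ false
  wallʸ p q p≤d q≤d q° = trans (path-sym p q) (wallˣ q p q≤d p≤d q°)

  harmonic : ∀ p q → interior p ≡ true → interior q ≡ true → Lap path p q ≡ false
  harmonic (suc p) (suc q) _ _ = path-harmonic p q

  boundary : ∀ {X} → d ∣ X → ∀ Y → path (fold X) (fold Y) ≡ false
  boundary {X} d∣X Y = wallˣ (fold X) (fold Y) (fold-≤ X) (fold-≤ Y) (∣⇒wall X d∣X)

  solution : Solution m n (λ _ _ → false)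
  solution = record
    { F        = λ X Y → path (fold X) (fold Y)
    ; F-left   = boundary (divides 0 refl)
    ; F-right  = boundary (gcd[m,n]∣m (suc m) (suc n))
    ; F-bottom = λ X → trans (path-sym (fold X) 0) (boundary (divides 0 refl) X)
    ; F-top    = λ X → trans (path-sym (fold X) _) (boundary (gcd[m,n]∣n (suc m) (suc n)) X)
    ; Lap-F    = λ x y _ _ → pullback-harmonic path wallˣ wallʸ harmonic x y
    }

cancelling-multiple : ∀ M n {b} → gcd M (suc n) ∣ b → ∃[ T ] M ∣ T × suc n ∣ T + b
cancelling-multiple M n (divides β refl) with Bézout.identity (gcd-GCD M (suc n))
... | Bézout.-+ x y eq = β * x * M , divides (β * x) refl , divides (β * y) (begin
  β * x * M + β * d  ≡⟨ regroup β x M d ⟩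
  β * (d + x * M)    ≡⟨ cong (β *_) eq ⟩
  β * (y * suc n)    ≡⟨ sym (*-assoc β y (suc n)) ⟩
  β * y * suc n      ∎)
  where
  open ≡-Reasoning
  d = gcd M (suc n)
  regroup : ∀ β x M d → β * x * M + β * d ≡ β * (d + x * M)
  regroup = solve-∀
-- Here x M ≡ d (mod suc n), so T = n β x M ≡ −β d = −b since n ≡ −1.
... | Bézout.+- x y eq =
  n * (β * x) * M , divides (n * (β * x)) refl , divides (β * d + n * (β * y)) (begin
  n * (β * x) * M + β * d          ≡⟨ cong (_+ β * d) (regroup n β x M) ⟩
  n * β * (x * M) + β * d          ≡⟨ cong (λ z → n * β * z + β * d) (sym eq) ⟩
  n * β * (d + y * suc n) + β * d  ≡⟨ collect n β d y ⟩
  (β * d + n * (β * y)) * suc n    ∎)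
  where
  open ≡-Reasoning
  d = gcd M (suc n)
  regroup : ∀ n β x M → n * (β * x) * M ≡ n * β * (x * M)
  regroup = solve-∀
  collect : ∀ n β d y → n * β * (d + y * suc n) + β * d ≡ (β * d + n * (β * y)) * suc n
  collect = solve-∀

module RaySolution (m n a b T : ℕ) (a<m : a < m) (b<n : b < n)
                   (M∣T : suc m ∣ T) (N∣T+b : suc n ∣ T + suc b) where
  module FM = Folding (suc m) (s≤s z≤n)
  module FN = Folding (suc n) (s≤s z≤n)
  open Unfolding (suc m) (suc n) (s≤s z≤n) (s≤s z≤n) using (pushforward-Lap)

  folds-to : ℕ → ℕ → ℕ → ℕ → Bool
  folds-to X Y x y = FM.visits x X ∧ FN.visits y Y

  F : ℕ → ℕ → Bool
  F x y = parallelogramSum a (suc b) T (λ X Y → folds-to X Y x y)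

  Lap-F : ∀ x y → x < m → y < n → Lap F (suc x) (suc y) ≡ point (suc a) (suc b) (suc x) (suc y)
  Lap-F x y x<m y<n = begin
    Lap F (suc x) (suc y)
      ≡⟨ Lap-linear (λ g → parallelogramSum a (suc b) T (λ X Y → g (X , Y)))
                    (λ f g → parallelogramSum-xor a (suc b) T (λ X Y → f (X , Y)) (λ X Y → g (X , Y)))
                    (λ (X , Y) → folds-to X Y) (suc x) (suc y) ⟩
    parallelogramSum a (suc b) T (λ X Y → Lap (folds-to X Y) (suc x) (suc y))
      ≡⟨ parallelogramSum-cong a (suc b) T {λ X Y → Lap (folds-to X Y) (suc x) (suc y)} {Lap D}
                               (λ X Y → pushforward-Lap x y X Y x° y°) ⟩
    parallelogramSum a (suc b) T (Lap D)
      ≡⟨ Lap-parallelogram a (suc b) T D ⟩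
    (D (T + 0) (T + (suc a + suc b)) xor D (T + suc a) (T + suc b)) xor
    (D 0 (suc a + suc b) xor D (suc a) (suc b))
      ≡⟨ cong₂ _xor_ (cong₂ _xor_ far-left far-top) (cong₂ _xor_ near-left near) ⟩
    point (suc a) (suc b) (suc x) (suc y) ∎
    where
    open ≡-Reasoning
    x° = FM.interior-true (s≤s z≤n) (s≤s x<m)
    y° = FN.interior-true (s≤s z≤n) (s≤s y<n)
    D : ℕ → ℕ → Bool
    D X Y = folds-to X Y (suc x) (suc y)
    far-left : D (T + 0) (T + (suc a + suc b)) ≡ false
    far-left rewrite FM.visits-wall (suc x) (subst (suc m ∣_) (sym (+-identityʳ T)) M∣T) = refl
    far-top : D (T + suc a) (T + suc b) ≡ false
    far-top rewrite FN.visits-wall (suc y) N∣T+b = ∧-zeroʳ _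
    near-left : D 0 (suc a + suc b) ≡ false
    near-left rewrite FM.visits-wall (suc x) {0} (divides 0 refl) = refl
    near : D (suc a) (suc b) ≡ point (suc a) (suc b) (suc x) (suc y)
    near = cong₂ _∧_ (FM.visits-< {suc x} {suc a} x° (s≤s a<m))
                     (FN.visits-< {suc y} {suc b} y° (s≤s b<n))

  solution : Solution m n (point (suc a) (suc b))
  solution = record
    { F        = F
    ; F-left   = λ y → parallelogramSum-false a (suc b) T (λ X Y → refl)
    ; F-right  = λ y → parallelogramSum-false a (suc b) T (λ X Y →
                   cong (_∧ FN.visits y Y) (FM.visits-P X))
    ; F-bottom = λ x → parallelogramSum-false a (suc b) T (λ X Y → ∧-zeroʳ (FM.visits x X))
    ; F-top    = λ x → parallelogramSum-false a (suc b) T (λ X Y →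
                   trans (cong (FM.visits x X ∧_) (FN.visits-P Y)) (∧-zeroʳ (FM.visits x X)))
    ; Lap-F    = Lap-F
    }

ray-solution : ∀ {m n} a b → a < m → b < n → gcd (suc m) (suc n) ∣ suc b →
               Solution m n (point (suc a) (suc b))
ray-solution {m} {n} a b a<m b<n d∣b with cancelling-multiple (suc m) n d∣b
... | T , M∣T , N∣T+b = RaySolution.solution m n a b T a<m b<n M∣T N∣T+b

N-solution : ∀ {m n} a b → a < m → b < n → gcd (suc m) (suc n) ∣ suc a ⊎ gcd (suc m) (suc n) ∣ suc b →
             Solution m n (point (suc a) (suc b))
N-solution a b a<m b<n (inj₂ d∣b) = ray-solution a b a<m b<n d∣b
N-solution {m} {n} a b a<m b<n (inj₁ d∣a) = retarget (λ x y → ∧-comm (suc b ≡ᵇ y) (suc a ≡ᵇ x))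
  (transpose (ray-solution b a b<n a<m (subst (_∣ suc a) (gcd-comm (suc m) (suc n)) d∣a)))

-- The grid graph

data Axis : Set where
  horizontal vertical : Axis

Direction : Set
Direction = Axis × Sign

shift : Sign → ℕ → ℕ
shift Sign.+ = suc
shift Sign.- = pred

move : Direction → ℕ × ℕ → ℕ × ℕ
move (horizontal , s) (x , y) = shift s x , y
move (vertical   , s) (x , y) = x , shift s y

directions : List Direction
directions =
  (horizontal , Sign.+) ∷ (horizontal , Sign.-) ∷ (vertical , Sign.+) ∷ (vertical , Sign.-) ∷ []

directions-unique : Unique directions
directions-unique =
  ((λ ()) ∷ (λ ()) ∷ (λ ()) ∷ []) ∷ ((λ ()) ∷ (λ ()) ∷ []) ∷ ((λ ()) ∷ []) ∷ [] ∷ []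

∈-directions : ∀ d → d ∈ directions
∈-directions (horizontal , Sign.+) = here refl
∈-directions (horizontal , Sign.-) = there (here refl)
∈-directions (vertical   , Sign.+) = there (there (here refl))
∈-directions (vertical   , Sign.-) = there (there (there (here refl)))

Lap-directions : ∀ F x y → xors (map (λ d → uncurry F (move d (x , y))) directions) ≡ Lap F x y
Lap-directions F x y =
  trans (cong (λ b → F (suc x) y xor F (pred x) y xor F x (suc y) xor b) (xor-identityʳ (F x (pred y))))
        (sym (xor-assoc (F (suc x) y) (F (pred x) y) _))

shift-≢ : ∀ s a → shift s (suc a) ≢ suc a
shift-≢ Sign.+ a = 1+n≢n
shift-≢ Sign.- a = 1+n≢n ∘ sym

shift-injective : ∀ s s' a → shift s (suc a) ≡ shift s' (suc a) → s ≡ s'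
shift-injective Sign.+ Sign.+ a _ = refl
shift-injective Sign.- Sign.- a _ = refl
shift-injective Sign.+ Sign.- a e = ⊥-elim (<⇒≢ (m<n+m a z<s) (sym e))
shift-injective Sign.- Sign.+ a e = ⊥-elim (<⇒≢ (m<n+m a z<s) e)

move-injective : ∀ d d' a b → move d (suc a , suc b) ≡ move d' (suc a , suc b) → d ≡ d'
move-injective (horizontal , s) (horizontal , s') a b e =
  cong (horizontal ,_) (shift-injective s s' a (cong proj₁ e))
move-injective (horizontal , s) (vertical   , s') a b e = ⊥-elim (shift-≢ s a (cong proj₁ e))
move-injective (vertical   , s) (horizontal , s') a b e = ⊥-elim (shift-≢ s' a (sym (cong proj₁ e)))
move-injective (vertical   , s) (vertical   , s') a b e =
  cong (vertical ,_) (shift-injective s s' b (cong proj₂ e))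

∣-∣≡1⇒shift : ∀ a a' → ∣ a - a' ∣ ≡ 1 → ∃[ s ] suc a' ≡ shift s (suc a)
∣-∣≡1⇒shift zero          (suc zero) _ = Sign.+ , refl
∣-∣≡1⇒shift (suc zero)    zero       _ = Sign.- , refl
∣-∣≡1⇒shift (suc a)       (suc a') e with ∣-∣≡1⇒shift a a' e
... | Sign.+ , e' = Sign.+ , cong suc e'
... | Sign.- , e' = Sign.- , cong suc e'
∣-∣≡1⇒shift zero          (suc (suc a')) ()
∣-∣≡1⇒shift (suc (suc a)) zero           ()

∣n-1+n∣≡1 : ∀ a → ∣ a - suc a ∣ ≡ 1
∣n-1+n∣≡1 zero    = refl
∣n-1+n∣≡1 (suc a) = ∣n-1+n∣≡1 a

shift⇒∣-∣≡1 : ∀ s a a' → suc a' ≡ shift s (suc a) → ∣ a - a' ∣ ≡ 1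
shift⇒∣-∣≡1 Sign.+ a a' e rewrite suc-injective e = ∣n-1+n∣≡1 a
shift⇒∣-∣≡1 Sign.- a a' refl = trans (∣-∣-comm (suc a') a') (∣n-1+n∣≡1 a')

parity-suc : ∀ k → parity (suc k) ≡ parity k ⁻¹
parity-suc k = sym (⁻¹-selfInverse (suc-homo-⁻¹ k))

colour : ℕ × ℕ → Parity
colour (x , y) = parity (x + y)

colour-move : ∀ d x y → colour (move d (suc x , suc y)) ≡ colour (suc x , suc y) ⁻¹
colour-move (horizontal , Sign.+) x y = parity-suc (suc x + suc y)
colour-move (horizontal , Sign.-) x y = sym (suc-homo-⁻¹ (x + suc y))
colour-move (vertical   , Sign.+) x y rewrite +-suc x (suc y) = parity-suc (suc (x + suc y))
colour-move (vertical   , Sign.-) x y rewrite +-suc x y = sym (suc-homo-⁻¹ (suc (x + y)))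

restrict : (ℕ → ℕ → Bool) → Parity → ℕ → ℕ → Bool
restrict F c x y = F x y ∧ does (colour (x , y) ≟ₚ c)

restrict-colour : ∀ F c x y → restrict F c x y ≡ true → colour (x , y) ≡ c
restrict-colour F c x y Fc with colour (x , y) ≟ₚ c
... | yes same = same
... | no _ with () ← trans (sym (∧-zeroʳ (F x y))) Fc

restrict-off : ∀ F c x y → colour (x , y) ≢ c → restrict F c x y ≡ false
restrict-off F c x y ≢c =
  trans (cong (F x y ∧_) (dec-false (colour (x , y) ≟ₚ c) ≢c)) (∧-zeroʳ (F x y))

Lap-restrict : ∀ F c x y → Lap (restrict F c) (suc x) (suc y)
                          ≡ Lap F (suc x) (suc y) ∧ does (colour (suc x , suc y) ⁻¹ ≟ₚ c)
Lap-restrict F c x y = begin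
  Lap (restrict F c) (suc x) (suc y)
    ≡⟨ sym (Lap-directions (restrict F c) (suc x) (suc y)) ⟩
  xors (map (λ d → uncurry (restrict F c) (move d (suc x , suc y))) directions)
    ≡⟨ xors-cong {xs = directions} {f = λ d → uncurry (restrict F c) (move d (suc x , suc y))}
                 (All.tabulate λ {d} _ → cong (λ p → F′ d ∧ does (p ≟ₚ c)) (colour-move d x y)) ⟩
  xors (map (λ d → F′ d ∧ κ) directions)
    ≡⟨ xors-∧ F′ κ directions ⟩
  xors (map F′ directions) ∧ κ
    ≡⟨ cong (_∧ κ) (Lap-directions F (suc x) (suc y)) ⟩
  Lap F (suc x) (suc y) ∧ κ ∎
  where
  open ≡-Reasoning
  F′ : Direction → Bool
  F′ d = uncurry F (move d (suc x , suc y))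
  κ = does (colour (suc x , suc y) ⁻¹ ≟ₚ c)

step? : ∀ {k} → Sign → Fin k → Maybe (Fin k)
step? {k} Sign.+ i with suc (toℕ i) <? k
... | yes i+1<k = just (fromℕ< i+1<k)
... | no _      = nothing
step? Sign.- zero    = nothing
step? Sign.- (suc i) = just (inject₁ i)

step?-just : ∀ {k} s (i : Fin k) {i'} → step? s i ≡ just i' → suc (toℕ i') ≡ shift s (suc (toℕ i))
step?-just {k} Sign.+ i e with suc (toℕ i) <? k
step?-just Sign.+ i refl | yes i+1<k = cong suc (toℕ-fromℕ< i+1<k)
step?-just Sign.- (suc i) refl = cong suc (toℕ-inject₁ i)

step?-nothing : ∀ {k} s (i : Fin k) → step? s i ≡ nothing →
                shift s (suc (toℕ i)) ≡ 0 ⊎ shift s (suc (toℕ i)) ≡ suc k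
step?-nothing {k} Sign.+ i e with suc (toℕ i) <? k
... | no i+1≮k = inj₂ (cong suc (≤-antisym (toℕ<n i) (≮⇒≥ i+1≮k)))
step?-nothing Sign.- zero _ = inj₁ refl

module GridGame (m n : ℕ) where

  V : Set
  V = Fin m × Fin n

  coords : V → ℕ × ℕ
  coords (i , j) = suc (toℕ i) , suc (toℕ j)

  coords-injective : ∀ {u w} → coords u ≡ coords w → u ≡ w
  coords-injective e =
    cong₂ _,_ (toℕ-injective (suc-injective (cong proj₁ e))) (toℕ-injective (suc-injective (cong proj₂ e)))

  OnWall : ℕ × ℕ → Set
  OnWall (x , y) = (x ≡ 0 ⊎ x ≡ suc m) ⊎ (y ≡ 0 ⊎ y ≡ suc n)

  coords-inside : ∀ u → ¬ OnWall (coords u)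
  coords-inside (i , j) (inj₁ (inj₂ e)) = <-irrefl (suc-injective e) (toℕ<n i)
  coords-inside (i , j) (inj₂ (inj₂ e)) = <-irrefl (suc-injective e) (toℕ<n j)

  neighbour : V → Direction → Maybe V
  neighbour (i , j) (horizontal , s) = Maybe.map (_, j) (step? s i)
  neighbour (i , j) (vertical   , s) = Maybe.map (i ,_) (step? s j)

  neighbour-just : ∀ u d {w} → neighbour u d ≡ just w → coords w ≡ move d (coords u)
  neighbour-just (i , j) (horizontal , s) e with step? s i in step
  neighbour-just (i , j) (horizontal , s) refl | just i' = cong (_, suc (toℕ j)) (step?-just s i step)
  neighbour-just (i , j) (vertical   , s) e with step? s j in step
  neighbour-just (i , j) (vertical   , s) refl | just j' = cong (suc (toℕ i) ,_) (step?-just s j step)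

  neighbour-nothing : ∀ u d → neighbour u d ≡ nothing → OnWall (move d (coords u))
  neighbour-nothing (i , j) (horizontal , s) e with step? s i in step
  ... | nothing = inj₁ (step?-nothing s i step)
  neighbour-nothing (i , j) (vertical   , s) e with step? s j in step
  ... | nothing = inj₂ (step?-nothing s j step)

  Grid⇒move : ∀ {u w} → Grid m n u w → ∃[ d ] coords w ≡ move d (coords u)
  Grid⇒move {i , j} {i' , j'} g with ∣ toℕ i - toℕ i' ∣ in di | ∣ toℕ j - toℕ j' ∣ in dj
  ... | zero | _ with ∣-∣≡1⇒shift (toℕ j) (toℕ j') (trans dj g)
  ...   | s , j'≡ = (vertical , s) , cong₂ _,_ (cong suc (sym (∣m-n∣≡0⇒m≡n di))) j'≡
  Grid⇒move {i , j} {i' , j'} g | suc zero | zero with ∣-∣≡1⇒shift (toℕ i) (toℕ i') di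
  ...   | s , i'≡ = (horizontal , s) , cong₂ _,_ i'≡ (cong suc (sym (∣m-n∣≡0⇒m≡n dj)))

  move⇒Grid : ∀ {u w} d → coords w ≡ move d (coords u) → Grid m n u w
  move⇒Grid {i , j} {i' , j'} (horizontal , s) e =
    cong₂ _+_ (shift⇒∣-∣≡1 s (toℕ i) (toℕ i') (cong proj₁ e))
              (m≡n⇒∣m-n∣≡0 (sym (suc-injective (cong proj₂ e))))
  move⇒Grid {i , j} {i' , j'} (vertical , s) e =
    cong₂ _+_ (m≡n⇒∣m-n∣≡0 (sym (suc-injective (cong proj₁ e))))
              (shift⇒∣-∣≡1 s (toℕ j) (toℕ j') (cong proj₂ e))

  Grid? : ∀ u w → Dec (Grid m n u w)
  Grid? (i , j) (i' , j') = ∣ toℕ i - toℕ i' ∣ + ∣ toℕ j - toℕ j' ∣ ≟ 1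

  Grid-sym : ∀ {u w} → Grid m n u w → Grid m n w u
  Grid-sym {i , j} {i' , j'} =
    subst (_≡ 1) (cong₂ _+_ (∣-∣-comm (toℕ i) (toℕ i')) (∣-∣-comm (toℕ j) (toℕ j')))

  neighbours : V → List V
  neighbours u = mapMaybe (neighbour u) directions

  neighbours-unique : ∀ u → Unique (neighbours u)
  neighbours-unique u@(i , j) = mapMaybe-unique {f = neighbour u}
    (λ {d} {d'} e e' → move-injective d d' (toℕ i) (toℕ j)
                         (trans (sym (neighbour-just u d e)) (neighbour-just u d' e')))
    directions-unique

  neighbours-complete : ∀ {u w} → Grid m n u w → w ∈ neighbours u
  neighbours-complete {u} {w} g with Grid⇒move g
  ... | d , w≡ with neighbour u d in nb
  ...   | just w' = ∈-mapMaybe⁺ {f = neighbour u} (∈-directions d)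
                      (trans nb (cong just (coords-injective (trans (neighbour-just u d nb) (sym w≡)))))
  ...   | nothing = ⊥-elim (coords-inside w (subst OnWall (sym w≡) (neighbour-nothing u d nb)))

  vertices : List V
  vertices = cartesianProduct (allFin m) (allFin n)

  ∈-vertices : ∀ u → u ∈ vertices
  ∈-vertices (i , j) = ∈-cartesianProduct⁺ (∈-allFin i) (∈-allFin j)

  module Play {target} (S : Solution m n target) (c : Parity) where
    open Solution S

    A : V → Bool
    A u = uncurry (restrict F c) (coords u)

    A-independent : ∀ {u w} → Grid m n u w → A u ≡ true → A w ≡ false
    A-independent {u@(i , j)} {w} g Au with Grid⇒move g
    ... | d , w≡ = restrict-off F c _ _ λ w-c → p≢p⁻¹ c (sym (trans (sym colour-w) w-c))
      where
      colour-w : colour (coords w) ≡ c ⁻¹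
      colour-w = trans (cong colour w≡)
                       (trans (colour-move d (toℕ i) (toℕ j)) (cong _⁻¹ (restrict-colour F c _ _ Au)))

    open Geography (≡-dec Fin._≟_ Fin._≟_) vertices ∈-vertices (Grid m n) neighbours
                   neighbours-unique neighbours-complete A A-independent public

    grid : Subgraph (Grid m n)
    grid = record { decide = Grid? ; symmetric = λ {u} {w} → Grid-sym {u} {w} ; ⊆H₀ = λ g → g }

    oddA-grid : ∀ u → oddA grid u ≡ uncurry target (coords u) ∧ does (colour (coords u) ⁻¹ ≟ₚ c)
    oddA-grid u@(i , j) = begin
      oddA grid u
        ≡⟨ xors-mapMaybe {f = neighbour u} (A-neighbour grid u) directions ⟩
      xors (map (maybe′ (A-neighbour grid u) false ∘ neighbour u) directions)
        ≡⟨ xors-cong {xs = directions} {f = maybe′ (A-neighbour grid u) false ∘ neighbour u}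
                     (All.tabulate λ {d} _ → towards d) ⟩
      xors (map (λ d → uncurry (restrict F c) (move d (coords u))) directions)
        ≡⟨ Lap-directions (restrict F c) (suc (toℕ i)) (suc (toℕ j)) ⟩
      Lap (restrict F c) (suc (toℕ i)) (suc (toℕ j))
        ≡⟨ Lap-restrict F c (toℕ i) (toℕ j) ⟩
      Lap F (suc (toℕ i)) (suc (toℕ j)) ∧ _
        ≡⟨ cong (_∧ _) (Lap-F (toℕ i) (toℕ j) (toℕ<n i) (toℕ<n j)) ⟩
      uncurry target (coords u) ∧ _ ∎
      where
      open ≡-Reasoning
      wall : ∀ p → OnWall p → uncurry F p ≡ false
      wall (x , y) (inj₁ (inj₁ refl)) = F-left y
      wall (x , y) (inj₁ (inj₂ refl)) = F-right y
      wall (x , y) (inj₂ (inj₁ refl)) = F-bottom x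
      wall (x , y) (inj₂ (inj₂ refl)) = F-top x
      towards : ∀ d → maybe′ (A-neighbour grid u) false (neighbour u d)
                      ≡ uncurry (restrict F c) (move d (coords u))
      towards d with neighbour u d in nb
      ... | just w  rewrite dec-true (Grid? u w) (move⇒Grid d (neighbour-just u d nb)) =
        cong (uncurry (restrict F c)) (neighbour-just u d nb)
      ... | nothing rewrite wall _ (neighbour-nothing u d nb) = refl

  harmonic⇒IsP : (S : Solution m n (λ _ _ → false)) → ∀ v → uncurry (Solution.F S) (coords v) ≡ true →
                 IsP (Grid m n) v
  harmonic⇒IsP S v Fv = evenOutside⇒IsP grid (λ u _ → oddA-grid u) Av
    where
    open Play S (colour (coords v))
    Av : A v ≡ true
    Av rewrite Fv = dec-true (colour (coords v) ≟ₚ colour (coords v)) refl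

  point⇒IsN : ∀ v → Solution m n (uncurry point (coords v)) → IsN (Grid m n) v
  point⇒IsN v S = oddAt⇒IsN grid odd even
    where
    open Play S (colour (coords v) ⁻¹)
    odd : oddA grid v ≡ true
    odd = trans (oddA-grid v)
                (cong₂ _∧_ (uncurry point-self (coords v)) (dec-true (colour (coords v) ⁻¹ ≟ₚ _) refl))
    even : ∀ u → u ≢ v → A u ≡ false → oddA grid u ≡ false
    even u u≢v _ = trans (oddA-grid u) (cong (_∧ does (colour (coords u) ⁻¹ ≟ₚ colour (coords v) ⁻¹))
                                             (point-other (λ e → u≢v (sym (coords-injective e)))))

theorem1p2 : (m n : ℕ) → 1 ≤ m → 1 ≤ n → (i : Fin m) (j : Fin n) →
    IsP (Grid m n) (i , j) ⇔
      ((¬ (gcd (suc m) (suc n) ∣ suc (toℕ i))) × (¬ (gcd (suc m) (suc n) ∣ suc (toℕ j))))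
theorem1p2 m n _ _ i j = mk⇔
  (λ P → (λ d∣a → IsN⇒¬IsP (N-position (inj₁ d∣a)) P) , (λ d∣b → IsN⇒¬IsP (N-position (inj₂ d∣b)) P))
  (λ (d∤a , d∤b) → let S , S-hits = P-solution (toℕ i) (toℕ j) d∤a d∤b
                    in harmonic⇒IsP S (i , j) S-hits)
  where
  open GridGame m n
  N-position : gcd (suc m) (suc n) ∣ suc (toℕ i) ⊎ gcd (suc m) (suc n) ∣ suc (toℕ j) →
               IsN (Grid m n) (i , j)
  N-position d∣ = point⇒IsN (i , j) (N-solution (toℕ i) (toℕ j) (toℕ<n i) (toℕ<n j) d∣)
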